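{- Let $\mathcal{M}_1=(S_1,T_1,P_1,\Phi_1)$ and $\mathcal{M}_2=(S_2,T_2,P_2,\Phi_2)$ be finite PMTS over an action alphabet $\Sigma$ with $P_1,P_2$ disjoint from each other and from all other atoms, and let $s\in S_1$, $t\in S_2$. Let $X_R=S_1\times S_2$, $X_{T1}=T_1$, $X_{T2}=S_1\times T_2$ (elements of $X_{T2}$ written $(u,v,a,v')$ with $u\in S_1$, $(v,a,v')\in T_2$), and $Ap=X_R\uplus X_{T1}\uplus X_{T2}\uplus P_1\uplus P_2$. For $u\in S_1$ let $\pi_u$ map formulas of $\mathcal B((\Sigma\times S_1)\cup P_1)$ to $\mathcal B(Ap)$ by replacing each atom $(a,x)$ with $(u,a,x)$ and leaving parameters unchanged; for $u\in S_1,v\in S_2$ let $\pi_{u,v}$ map $\mathcal B((\Sigma\times S_2)\cup P_2)$ to $\mathcal B(Ap)$ by replacing each atom $(a,x)$ with $(u,v,a,x)$ and leaving parameters unchanged. Define $$\varphi_{u,v}=\bigwedge_{u^*=(u,a,u')\in X_{T1}}\Big(u^*\Rightarrow\bigvee_{v^*=(u,v,a,v')\in X_{T2}}\big(v^*\wedge (u',v')\big)\Big)\ \wedge\ \bigwedge_{v^*=(u,v,a,v')\in X_{T2}}\Big(v^*\Rightarrow\bigvee_{u^*=(u,a,u')\in X_{T1}}\big(u^*\wedge (u',v')\big)\Big)$$ (with the same action $a$ in inner and outer positions), $\psi_{u,v}=\pi_u(\Phi_1(u))\Rightarrow\big(\pi_{u,v}(\Phi_2(v))\wedge\varphi_{u,v}\big)$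 and $\Psi_{s,t}=(s,t)\wedge\bigwedge_{(u,v)\in X_R}((u,v)\Rightarrow\psi_{u,v})$. Then $s\le_m t$ if and only if the quantified Boolean formula $\forall P_1\,\exists P_2\,\exists X_R\,\forall X_{T1}\,\exists X_{T2}\,\Psi_{s,t}$ is true.
   Context: Boolean formulae over a set $X$ of atoms: $\varphi::=\mathbf{tt}\mid x\mid\neg\varphi\mid\varphi\wedge\varphi\mid\varphi\vee\varphi$; $\mathcal B(X)$ is the set of them; a valuation $\nu\subseteq X$ satisfies formulas in the standard way; $\mathbf{ff}$ denotes $\neg\mathbf{tt}$. A PMTS (parametric modal transition system) over $\Sigma$ is a tuple $(S,T,P,\Phi)$ with $S$ a set of states, $T\subseteq S\times\Sigma\times S$, $P$ a finite set of parameters and $\Phi:S\to\mathcal B((\Sigma\times S)\cup P)$ such that whenever $(a,t)$ occurs in $\Phi(s)$ then $(s,a,t)\in T$. A BMTS is a PMTS with $P=\emptyset$. For a state $s$, $T(s)=\{(a,t)\mid(s,a,t)\in T\}$ and, for a BMTS, $\mathrm{Tran}(s)=\{E\subseteq T(s)\mid E\models\Phi(s)\}$. For a PMTS $\mathcal M$ and $\nu\subseteq P$, $\mathcal M^\nu$ is the BMTS $(S,T,\emptyset,\Phi')$ where $\Phi'(s)$ is $\Phi(s)$ with every $p\in\nu$ replaced by $\mathbf{tt}$ and every $p\notin\nu$ by $\mathbf{ff}$; $s^\nu$ is the state $s$ in $\mathcal M^\nu$. Modal refinement of BMTS states: $s_0\le_m t_0$ iff $(s_0,t_0)$ lies in a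 relation $R$ such that for every $(s,t)\in R$ and every $M\in\mathrm{Tran}(s)$ there is $N\in\mathrm{Tran}(t)$ with: every $(a,s')\in M$ has some $(a,t')\in N$ with $(s',t')\in R$, and every $(a,t')\in N$ has some $(a,s')\in M$ with $(s',t')\in R$. Modal refinement of PMTS states $s_0\in S_1,t_0\in S_2$: $s_0\le_m t_0$ iff for every $\mu\subseteq P_1$ there exists $\nu\subseteq P_2$ such that $s_0^\mu\le_m t_0^\nu$. -}

module Defs where

open import Data.Bool using (Bool; true; false; not; _∧_; _∨_)
open import Data.Nat using (ℕ)
open import Data.Fin using (Fin; _≟_)
open import Data.Product using (Σ; _×_; _,_; proj₁; proj₂)
open import Data.Sum using (_⊎_; inj₁; inj₂; [_,_])
open import Data.List using (List; []; _∷_; foldr; concatMap; allFin; cartesianProduct)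
open import Relation.Nullary.Decidable using (⌊_⌋)
open import Relation.Binary.PropositionalEquality using (_≡_; refl)

data Form (X : Set) : Set where
  tt   : Form X
  atom : X → Form X
  ¬f_  : Form X → Form X
  _∧f_ : Form X → Form X → Form X
  _∨f_ : Form X → Form X → Form X

ff : ∀ {X} → Form X
ff = ¬f tt

_⇒f_ : ∀ {X} → Form X → Form X → Form X
φ ⇒f ψ = (¬f φ) ∨f ψ

eval : ∀ {X} → (X → Bool) → Form X → Bool
eval ν tt = true
eval ν (atom x) = ν x
eval ν (¬f φ) = not (eval ν φ)
eval ν (φ ∧f ψ) = eval ν φ ∧ eval ν ψ
eval ν (φ ∨f ψ) = eval ν φ ∨ eval ν ψ

bind : ∀ {X Y} → (X → Form Y) → Form X → Form Y
bind σ tt = tt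
bind σ (atom x) = σ x
bind σ (¬f φ) = ¬f bind σ φ
bind σ (φ ∧f ψ) = bind σ φ ∧f bind σ ψ
bind σ (φ ∨f ψ) = bind σ φ ∨f bind σ ψ

⋀ : ∀ {X} → List (Form X) → Form X
⋀ = foldr _∧f_ tt

⋁ : ∀ {X} → List (Form X) → Form X
⋁ = foldr _∨f_ ff

-- The side condition
-- "(a,t) occurs in Φ(s) ⇒ (s,a,t) ∈ T" is built into the type:
-- Φ(s) is a formula over T(s) ⊎ P.

record Out {k n : ℕ} (T : Fin n → Fin k → Fin n → Bool) (s : Fin n) : Set where
  constructor _,_
  field
    lbl : Fin k × Fin n
    inT : T s (proj₁ lbl) (proj₂ lbl) ≡ true

act : ∀ {k n} {T : Fin n → Fin k → Fin n → Bool} {s} → Out T s → Fin k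
act o = proj₁ (Out.lbl o)

tgt : ∀ {k n} {T : Fin n → Fin k → Fin n → Bool} {s} → Out T s → Fin n
tgt o = proj₂ (Out.lbl o)

record PMTS (k : ℕ) : Set where
  field
    n : ℕ
    p : ℕ
    T : Fin n → Fin k → Fin n → Bool
    Φ : (s : Fin n) → Form (Out T s ⊎ Fin p)

record BMTS (k : ℕ) : Set where
  field
    n : ℕ
    T : Fin n → Fin k → Fin n → Bool
    Φ : (s : Fin n) → Form (Out T s)

Tran : ∀ {k} (M : BMTS k) (s : Fin (BMTS.n M)) → (Out (BMTS.T M) s → Bool) → Set
Tran M s E = eval E (BMTS.Φ M s) ≡ true

inst : ∀ {k} (M : PMTS k) → (Fin (PMTS.p M) → Bool) → BMTS k
inst M ν = record
  { n = PMTS.n M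
  ; T = PMTS.T M
  ; Φ = λ s → bind [ atom , (λ q → boolF (ν q)) ] (PMTS.Φ M s) }
  where
  boolF : ∀ {X} → Bool → Form X
  boolF true = tt
  boolF false = ff

IsModalRefinement : ∀ {k} (M₁ M₂ : BMTS k) →
  (Fin (BMTS.n M₁) → Fin (BMTS.n M₂) → Set) → Set
IsModalRefinement M₁ M₂ R =
  ∀ s t → R s t →
  ∀ (E : Out (BMTS.T M₁) s → Bool) → Tran M₁ s E →
  Σ (Out (BMTS.T M₂) t → Bool) λ F → Tran M₂ t F ×
    (∀ (m : Out (BMTS.T M₁) s) → E m ≡ true →
       Σ (Out (BMTS.T M₂) t) λ m' → F m' ≡ true × act m ≡ act m' × R (tgt m) (tgt m')) ×
    (∀ (m' : Out (BMTS.T M₂) t) → F m' ≡ true →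
       Σ (Out (BMTS.T M₁) s) λ m → E m ≡ true × act m ≡ act m' × R (tgt m) (tgt m'))

RefB : ∀ {k} (M₁ : BMTS k) → Fin (BMTS.n M₁) → (M₂ : BMTS k) → Fin (BMTS.n M₂) → Set₁
RefB M₁ s M₂ t =
  Σ (Fin (BMTS.n M₁) → Fin (BMTS.n M₂) → Set) λ R → IsModalRefinement M₁ M₂ R × R s t

RefP : ∀ {k} (M₁ : PMTS k) → Fin (PMTS.n M₁) → (M₂ : PMTS k) → Fin (PMTS.n M₂) → Set₁
RefP M₁ s M₂ t =
  ∀ (μ : Fin (PMTS.p M₁) → Bool) → Σ (Fin (PMTS.p M₂) → Bool) λ ν →
    RefB (inst M₁ μ) s (inst M₂ ν) t

pick : ∀ {A : Set} (b : Bool) → (b ≡ true → A) → List A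
pick true f = f refl ∷ []
pick false f = []

enumOut : ∀ {k n} (T : Fin n → Fin k → Fin n → Bool) (s : Fin n) → List (Out T s)
enumOut {k} {n} T s =
  concatMap (λ at → pick (T s (proj₁ at) (proj₂ at)) (λ e → at , e))
            (cartesianProduct (allFin k) (allFin n))

module Encoding {k : ℕ} (M₁ M₂ : PMTS k) where
  open PMTS M₁ renaming (n to n₁; p to p₁; T to T₁; Φ to Φ₁)
  open PMTS M₂ renaming (n to n₂; p to p₂; T to T₂; Φ to Φ₂)

  XR : Set
  XR = Fin n₁ × Fin n₂

  XT1 : Set
  XT1 = Σ (Fin n₁) λ u → Out T₁ u

  XT2 : Set
  XT2 = Fin n₁ × Σ (Fin n₂) λ v → Out T₂ v

  Ap : Set
  Ap = XR ⊎ XT1 ⊎ XT2 ⊎ Fin p₁ ⊎ Fin p₂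

  aR : XR → Form Ap
  aR x = atom (inj₁ x)
  aT1 : XT1 → Form Ap
  aT1 x = atom (inj₂ (inj₁ x))
  aT2 : XT2 → Form Ap
  aT2 x = atom (inj₂ (inj₂ (inj₁ x)))
  aP1 : Fin p₁ → Form Ap
  aP1 x = atom (inj₂ (inj₂ (inj₂ (inj₁ x))))
  aP2 : Fin p₂ → Form Ap
  aP2 x = atom (inj₂ (inj₂ (inj₂ (inj₂ x))))

  π₁ : (u : Fin n₁) → Form (Out T₁ u ⊎ Fin p₁) → Form Ap
  π₁ u = bind [ (λ o → aT1 (u , o)) , aP1 ]

  π₂ : (u : Fin n₁) (v : Fin n₂) → Form (Out T₂ v ⊎ Fin p₂) → Form Ap
  π₂ u v = bind [ (λ o → aT2 (u , v , o)) , aP2 ]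

  sameAct : Fin k → Fin k → Form Ap → Form Ap
  sameAct a b φ with ⌊ a ≟ b ⌋
  ... | true = φ
  ... | false = ff

  φ : Fin n₁ → Fin n₂ → Form Ap
  φ u v =
    ⋀ (Data.List.map (λ o →
         aT1 (u , o) ⇒f
           ⋁ (Data.List.map (λ o' → sameAct (act o) (act o')
                 (aT2 (u , v , o') ∧f aR (tgt o , tgt o')))
               (enumOut T₂ v)))
       (enumOut T₁ u))
    ∧f
    ⋀ (Data.List.map (λ o' →
         aT2 (u , v , o') ⇒f
           ⋁ (Data.List.map (λ o → sameAct (act o) (act o')
                 (aT1 (u , o) ∧f aR (tgt o , tgt o')))
               (enumOut T₁ u)))
       (enumOut T₂ v))

  ψ : Fin n₁ → Fin n₂ → Form Ap
  ψ u v = π₁ u (Φ₁ u) ⇒f (π₂ u v (Φ₂ v) ∧f φ u v)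

  Ψ : Fin n₁ → Fin n₂ → Form Ap
  Ψ s t = aR (s , t) ∧f
    ⋀ (Data.List.map (λ uv → aR uv ⇒f ψ (proj₁ uv) (proj₂ uv))
         (cartesianProduct (allFin n₁) (allFin n₂)))

  QBFTrue : Fin n₁ → Fin n₂ → Set
  QBFTrue s t =
    ∀ (μ : Fin p₁ → Bool) → Σ (Fin p₂ → Bool) λ ν →
    Σ (XR → Bool) λ r → ∀ (x₁ : XT1 → Bool) → Σ (XT2 → Bool) λ x₂ →
      eval [ r , [ x₁ , [ x₂ , [ μ , ν ] ] ] ] (Ψ s t) ≡ true

module Submission where

-- Fix valuations μ, ν of the parameters. A valuation r of X_R is a candidate relation, a valuation
-- of X_T1 picks for every u ∈ S₁ a set E_u of its outgoing transitions, and a valuation of X_T2 picks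
-- for every pair (u, v) a response F_uv among the outgoing transitions of v. Under such valuations
-- ψ_uv says "if E_u ∈ Tran(u) then F_uv ∈ Tran(v) and E_u, F_uv match up to r", so
-- ∀X_T1 ∃X_T2 Ψ_st holds exactly when r relates s and t and is a modal refinement of M₁^μ by M₂^ν:
-- a single X_T1 can present an arbitrary E at one chosen u, and conversely the refinement's
-- responses, chosen pair by pair, assemble into one X_T2. This gives the theorem for Boolean
-- relations. A modal refinement R ⊆ S₁ × S₂ need not be decidable, but on finite state sets it is
-- decidable up to double negation, and the existence of a Boolean certificate is itself decidable,
-- because all remaining quantifiers range over Boolean valuations of finite sets.

open import Defs

open import Axiom.UniquenessOfIdentityProofs using (module Decidable⇒UIP)
open import Data.Bool using (Bool; true; false; not; _∧_; _∨_)
import Data.Bool as Bool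
open import Data.Fin using (Fin; zero; suc)
import Data.Fin as Fin
open import Data.Fin.Properties using (∀-cons)
open import Data.List using (List; []; _∷_; map; concatMap; cartesianProduct; allFin)
import Data.List as List
open import Data.List.Membership.Propositional using (_∈_; lose)
open import Data.List.Membership.Propositional.Properties
  using (∈-concatMap⁺; ∈-map⁺; ∈-cartesianProduct⁺; ∈-allFin)
open import Data.List.Relation.Unary.All using (All; []; _∷_; tabulate; lookup)
open import Data.List.Relation.Unary.Any using (Any; here; there; satisfied; index)
open import Data.List.Relation.Unary.Any.Properties using (lookup-index)
open import Data.List.Relation.Unary.Enumerates.Setoid using (IsEnumeration)
open import Data.Nat using (ℕ; zero; suc)
open import Data.Product using (Σ; ∃; _×_; _,_; proj₁; proj₂; map₂)
open import Data.Product.Function.NonDependent.Propositional using (_×-⇔_)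
open import Data.Sum using (_⊎_; inj₁; inj₂; [_,_])
open import Data.Sum.Properties using ([,]-cong)
import Data.Vec.Functional as Vector
open import Function using (_∘_; _$_)
open import Function.Bundles using (_⇔_; mk⇔; Equivalence)
open import Function.Properties.Equivalence using () renaming (trans to ⇔-trans; refl to ⇔-refl)
open import Function.Related.TypeIsomorphisms using (→-cong-⇔)
open import Level using (0ℓ)
open import Relation.Binary.Definitions using (DecidableEquality)
open import Relation.Binary.PropositionalEquality
  using (_≡_; _≗_; refl; sym; trans; cong; cong₂; setoid)
open import Relation.Nullary using (Dec; yes; no; does; ¬?; _⊎-dec_; _×-dec_)
open import Relation.Nullary.Decidable using (map′; decidable-stable; ¬¬-excluded-middle; dec-yes-irr)
open import Relation.Nullary.Negation using (¬_; ¬¬-map; contradiction)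
open import Relation.Unary using (Pred; Decidable)

open Equivalence using (to; from)

∀⇒∃-cong : ∀ {I J : Set} {A : I → Set} {G H : I → J → Set} → (∀ {i j} → G i j ⇔ H i j) →
           (∀ i → A i → ∃ (G i)) ⇔ (∀ i → A i → ∃ (H i))
∀⇒∃-cong G⇔H = mk⇔ (λ h i → map₂ (to G⇔H) ∘ h i) (λ h i → map₂ (from G⇔H) ∘ h i)

⇔-true : ∀ {a b} → a ≡ b → a ≡ true ⇔ b ≡ true
⇔-true a≡b = mk⇔ (trans (sym a≡b)) (trans a≡b)

infix 4 _⊨_

_⊨_ : ∀ {X : Set} → (X → Bool) → Form X → Set
w ⊨ φ = eval w φ ≡ true

eval-cong : ∀ {X} {w w′ : X → Bool} → w ≗ w′ → ∀ φ → eval w φ ≡ eval w′ φ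
eval-cong w≗w′ tt       = refl
eval-cong w≗w′ (atom x) = w≗w′ x
eval-cong w≗w′ (¬f φ)   = cong not (eval-cong w≗w′ φ)
eval-cong w≗w′ (φ ∧f ψ) = cong₂ _∧_ (eval-cong w≗w′ φ) (eval-cong w≗w′ ψ)
eval-cong w≗w′ (φ ∨f ψ) = cong₂ _∨_ (eval-cong w≗w′ φ) (eval-cong w≗w′ ψ)

⊨-resp : ∀ {X} {w w′ : X → Bool} → w ≗ w′ → ∀ φ → w ⊨ φ → w′ ⊨ φ
⊨-resp w≗w′ φ = trans (sym (eval-cong w≗w′ φ))

eval-bind : ∀ {X Y} (w : Y → Bool) (σ : X → Form Y) φ →
            eval w (bind σ φ) ≡ eval (eval w ∘ σ) φ
eval-bind w σ tt       = refl
eval-bind w σ (atom x) = refl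
eval-bind w σ (¬f φ)   = cong not (eval-bind w σ φ)
eval-bind w σ (φ ∧f ψ) = cong₂ _∧_ (eval-bind w σ φ) (eval-bind w σ ψ)
eval-bind w σ (φ ∨f ψ) = cong₂ _∨_ (eval-bind w σ φ) (eval-bind w σ ψ)

⊨-∧ : ∀ {X} {w : X → Bool} φ ψ → w ⊨ φ ∧f ψ ⇔ (w ⊨ φ × w ⊨ ψ)
⊨-∧ {w = w} φ ψ with eval w φ
... | true  = mk⇔ (refl ,_) proj₂
... | false = mk⇔ (λ ()) (λ ())

⊨-∨ : ∀ {X} {w : X → Bool} φ ψ → w ⊨ φ ∨f ψ ⇔ (w ⊨ φ ⊎ w ⊨ ψ)
⊨-∨ {w = w} φ ψ with eval w φ
... | true  = mk⇔ inj₁ (λ _ → refl)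
... | false = mk⇔ inj₂ [ (λ ()) , (λ e → e) ]

⊨-⇒ : ∀ {X} {w : X → Bool} φ ψ → w ⊨ φ ⇒f ψ ⇔ (w ⊨ φ → w ⊨ ψ)
⊨-⇒ {w = w} φ ψ with eval w φ
... | true  = mk⇔ (λ e _ → e) (_$ refl)
... | false = mk⇔ (λ _ ()) (λ _ → refl)

⊨-⋀ : ∀ {A X : Set} {w : X → Bool} (f : A → Form X) (xs : List A) →
      w ⊨ ⋀ (map f xs) ⇔ All (λ x → w ⊨ f x) xs
⊨-⋀ f []       = mk⇔ (λ _ → []) (λ _ → refl)
⊨-⋀ {w = w} f (x ∷ xs) = mk⇔
  (λ h → let h₁ , h₂ = to (⊨-∧ (f x) (⋀ (map f xs))) h in h₁ ∷ to (⊨-⋀ {w = w} f xs) h₂)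
  (λ { (p ∷ ps) → from (⊨-∧ (f x) (⋀ (map f xs))) (p , from (⊨-⋀ {w = w} f xs) ps) })

⊨-⋁ : ∀ {A X : Set} {w : X → Bool} (f : A → Form X) (xs : List A) →
      w ⊨ ⋁ (map f xs) ⇔ Any (λ x → w ⊨ f x) xs
⊨-⋁ f []       = mk⇔ (λ ()) (λ ())
⊨-⋁ {w = w} f (x ∷ xs) = mk⇔ forth back
  where
  forth : w ⊨ ⋁ (map f (x ∷ xs)) → Any (λ y → w ⊨ f y) (x ∷ xs)
  forth h with to (⊨-∨ (f x) (⋁ (map f xs))) h
  ... | inj₁ p = here p
  ... | inj₂ q = there (to (⊨-⋁ {w = w} f xs) q)
  back : Any (λ y → w ⊨ f y) (x ∷ xs) → w ⊨ ⋁ (map f (x ∷ xs))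
  back (here p)   = from (⊨-∨ (f x) (⋁ (map f xs))) (inj₁ p)
  back (there ps) = from (⊨-∨ (f x) (⋁ (map f xs))) (inj₂ (from (⊨-⋁ {w = w} f xs) ps))

module _ {A X : Set} {w : X → Bool} (f : A → Form X) {xs : List A}
         (enum : IsEnumeration (setoid A) xs) where

  ⊨-⋀-enum : w ⊨ ⋀ (map f xs) ⇔ (∀ x → w ⊨ f x)
  ⊨-⋀-enum = mk⇔ (λ h x → lookup (to (⊨-⋀ f xs) h) (enum x))
                 (λ h → from (⊨-⋀ f xs) (tabulate (λ {x} _ → h x)))

  ⊨-⋁-enum : w ⊨ ⋁ (map f xs) ⇔ ∃ (λ x → w ⊨ f x)
  ⊨-⋁-enum = mk⇔ (satisfied ∘ to (⊨-⋁ f xs))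
                 (λ (x , p) → from (⊨-⋁ f xs) (lose (enum x) p))

⋀⇒⋁ : ∀ {I J X : Set} → (I → Form X) → (I → J → Form X) → List I → List J → Form X
⋀⇒⋁ a g is js = ⋀ (map (λ i → a i ⇒f ⋁ (map (g i) js)) is)

⊨-⋀⇒⋁ : ∀ {I J X : Set} {w : X → Bool} {is : List I} {js : List J} →
         IsEnumeration (setoid I) is → IsEnumeration (setoid J) js →
         (a : I → Form X) (g : I → J → Form X) →
         w ⊨ ⋀⇒⋁ a g is js ⇔ (∀ i → w ⊨ a i → ∃ λ j → w ⊨ g i j)
⊨-⋀⇒⋁ {js = js} is-enum js-enum a g = mk⇔
  (λ h i → to (⊨-⋁-enum (g i) js-enum) ∘ to (⊨-⇒ (a i) (b i)) (to (⊨-⋀-enum a⇒b is-enum) h i))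
  (λ h → from (⊨-⋀-enum a⇒b is-enum) λ i → from (⊨-⇒ (a i) (b i)) (from (⊨-⋁-enum (g i) js-enum) ∘ h i))
  where
  b = λ i → ⋁ (map (g i) js)
  a⇒b = λ i → a i ⇒f b i

pick-∈ : ∀ {A : Set} b (f : b ≡ true → A) (e : b ≡ true) → f e ∈ pick b f
pick-∈ true f refl = here refl

enumOut-isEnumeration : ∀ {k n} (T : Fin n → Fin k → Fin n → Bool) s →
                        IsEnumeration (setoid (Out T s)) (enumOut T s)
enumOut-isEnumeration T s ((a , b) , e) =
  ∈-concatMap⁺ _ (lose (∈-cartesianProduct⁺ (∈-allFin a) (∈-allFin b)) (pick-∈ (T s a b) _ e))

Σ-isEnumeration : ∀ {A : Set} {B : A → Set} {xs : List A} {ys : ∀ a → List (B a)} →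
                  IsEnumeration (setoid A) xs → (∀ a → IsEnumeration (setoid (B a)) (ys a)) →
                  IsEnumeration (setoid (Σ A B)) (concatMap (λ a → map (a ,_) (ys a)) xs)
Σ-isEnumeration xs-enum ys-enum (a , b) =
  ∈-concatMap⁺ _ (lose (xs-enum a) (∈-map⁺ (a ,_) (ys-enum a b)))

Extensional : ∀ {A : Set} → Pred (A → Bool) 0ℓ → Set
Extensional P = ∀ {f g} → f ≗ g → P f → P g

Searchable : Set → Set₁
Searchable A = ∀ {P : Pred (A → Bool) 0ℓ} → Extensional P → Decidable P → Dec (∃ P)

∃-Bool? : ∀ {Q : Pred Bool 0ℓ} → Decidable Q → Dec (∃ Q)
∃-Bool? Q? = map′ [ (true ,_) , (false ,_) ] (λ { (true , q) → inj₁ q ; (false , q) → inj₂ q })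
                 (Q? true ⊎-dec Q? false)

searchable-Fin : ∀ m → Searchable (Fin m)
searchable-Fin zero    P-ext P? = map′ (_ ,_) (λ (f , p) → P-ext (λ ()) p) (P? (λ ()))
searchable-Fin (suc m) P-ext P? =
  map′ (λ (b , g , p) → b Vector.∷ g , p)
       (λ (f , p) → Vector.head f , Vector.tail f , P-ext head∷tail p)
       (∃-Bool? λ b → searchable-Fin m (P-ext ∘ cons-cong b) (P? ∘ (b Vector.∷_)))
  where
  head∷tail : ∀ {f : Fin (suc m) → Bool} → f ≗ Vector.head f Vector.∷ Vector.tail f
  head∷tail zero    = refl
  head∷tail (suc i) = refl
  cons-cong : ∀ b {g g′ : Fin m → Bool} → g ≗ g′ → b Vector.∷ g ≗ b Vector.∷ g′
  cons-cong b g≗g′ zero    = refl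
  cons-cong b g≗g′ (suc i) = g≗g′ i

searchable-retract : ∀ {A B : Set} (e : A → B) (d : B → A) → (∀ a → d (e a) ≡ a) →
                     Searchable B → Searchable A
searchable-retract e d d∘e≡id search-B P-ext P? =
  map′ (λ (g , p) → g ∘ e , p)
       (λ (f , p) → f ∘ d , P-ext (λ a → cong f (sym (d∘e≡id a))) p)
       (search-B (λ g≗g′ → P-ext (g≗g′ ∘ e)) (P? ∘ (_∘ e)))

searchable-enumeration : ∀ {A : Set} {xs : List A} → IsEnumeration (setoid A) xs → Searchable A
searchable-enumeration {xs = xs} enum =
  searchable-retract (index ∘ enum) (List.lookup xs) (sym ∘ lookup-index ∘ enum)
                     (searchable-Fin (List.length xs))

∀?-searchable : ∀ {A : Set} → Searchable A → ∀ {P : Pred (A → Bool) 0ℓ} →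
                Extensional P → Decidable P → Dec (∀ f → P f)
∀?-searchable search-A P-ext P? =
  map′ (λ ∄¬P f → decidable-stable (P? f) (λ ¬Pf → ∄¬P (f , ¬Pf)))
       (λ ∀P (f , ¬Pf) → ¬Pf (∀P f))
       (¬? (search-A (λ f≗g ¬Pf Pg → ¬Pf (P-ext (sym ∘ f≗g) Pg)) (¬? ∘ P?)))

¬¬-Π-Fin : ∀ m {Q : Fin m → Set} → (∀ i → ¬ ¬ Q i) → ¬ ¬ (∀ i → Q i)
¬¬-Π-Fin zero    _    ¬∀Q = ¬∀Q (λ ())
¬¬-Π-Fin (suc m) ¬¬Q ¬∀Q = ¬¬Q zero λ Q₀ → ¬¬-Π-Fin m (¬¬Q ∘ suc) λ Qₛ → ¬∀Q (∀-cons Q₀ Qₛ)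

¬¬-decidable₂ : ∀ {m n} (R : Fin m → Fin n → Set) → ¬ ¬ (∀ u v → Dec (R u v))
¬¬-decidable₂ {m} {n} R = ¬¬-Π-Fin m λ _ → ¬¬-Π-Fin n λ _ → ¬¬-excluded-middle

does⇔ : ∀ {A : Set} (A? : Dec A) → A ⇔ (does A? ≡ true)
does⇔ (yes a) = mk⇔ (λ _ → refl) (λ _ → a)
does⇔ (no ¬a) = mk⇔ (λ a → contradiction a ¬a) (λ ())

module _ {A : Set} {B : A → Set} (_≟_ : DecidableEquality A) where

  extend : (u : A) → (B u → Bool) → Σ A B → Bool
  extend u f (u′ , b) with u ≟ u′
  ... | yes refl = f b
  ... | no _     = false

  extend-fibre : ∀ u (f : B u → Bool) b → extend u f (u , b) ≡ f b
  extend-fibre u f b rewrite dec-yes-irr (u ≟ u) (Decidable⇒UIP.≡-irrelevant _≟_) refl = refl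

module _ {k : ℕ} (N₁ N₂ : BMTS k) where
  open BMTS N₁ using () renaming (n to n₁; T to T₁)
  open BMTS N₂ using () renaming (n to n₂; T to T₂)

  Matches : (Fin n₁ → Fin n₂ → Set) → ∀ {s t} → (Out T₁ s → Bool) → (Out T₂ t → Bool) → Set
  Matches R {s} {t} E F =
    (∀ (m : Out T₁ s) → E m ≡ true →
       Σ (Out T₂ t) λ m′ → F m′ ≡ true × act m ≡ act m′ × R (tgt m) (tgt m′)) ×
    (∀ (m′ : Out T₂ t) → F m′ ≡ true →
       Σ (Out T₁ s) λ m → E m ≡ true × act m ≡ act m′ × R (tgt m) (tgt m′))

  Matches-respˡ : ∀ {R s t} {E E′ : Out T₁ s → Bool} {F : Out T₂ t → Bool} →
                  E ≗ E′ → Matches R E F → Matches R E′ F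
  Matches-respˡ E≗E′ (forth , back) =
    (λ m E′m → forth m (trans (E≗E′ m) E′m)) ,
    (λ m′ Fm′ → let m , Em , rest = back m′ Fm′ in m , trans (sym (E≗E′ m)) Em , rest)

  IsModalRefinement-resp : ∀ {R R′ : Fin n₁ → Fin n₂ → Set} → (∀ {u v} → R u v ⇔ R′ u v) →
                           IsModalRefinement N₁ N₂ R → IsModalRefinement N₁ N₂ R′
  IsModalRefinement-resp R⇔R′ isRef s t R′st E tranE =
    let F , tranF , forth , back = isRef s t (from R⇔R′ R′st) E tranE in
    F , tranF ,
    (λ m Em → let m′ , Fm′ , a≡ , Rmm′ = forth m Em in m′ , Fm′ , a≡ , to R⇔R′ Rmm′) ,
    (λ m′ Fm′ → let m , Em , a≡ , Rmm′ = back m′ Fm′ in m , Em , a≡ , to R⇔R′ Rmm′)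

eval-inst : ∀ {k} (M : PMTS k) μ u (E : Out (PMTS.T M) u → Bool) →
            eval E (BMTS.Φ (inst M μ) u) ≡ eval [ E , μ ] (PMTS.Φ M u)
eval-inst M μ u E = trans (eval-bind E _ (PMTS.Φ M u)) (eval-cong atomwise (PMTS.Φ M u))
  where
  -- inst replaces a parameter by a constant built by a where-bound helper that cannot be named
  -- here; that constant is reached through the instance of the PMTS whose only formula is the parameter.
  parameter : ∀ q b → eval E (BMTS.Φ (inst (record M { Φ = λ _ → atom (inj₂ q) }) (λ _ → b)) u) ≡ b
  parameter q true  = refl
  parameter q false = refl
  atomwise : _ ≗ [ E , μ ]
  atomwise (inj₁ o) = refl
  atomwise (inj₂ q) = parameter q (μ q)

module EncodingCorrectness {k : ℕ} (M₁ M₂ : PMTS k)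
                           (μ : Fin (PMTS.p M₁) → Bool) (ν : Fin (PMTS.p M₂) → Bool) where
  open PMTS M₁ using () renaming (n to n₁; T to T₁; Φ to Φ₁)
  open PMTS M₂ using () renaming (n to n₂; T to T₂; Φ to Φ₂)
  open Encoding M₁ M₂

  M₁^μ : BMTS k
  M₁^μ = inst M₁ μ

  M₂^ν : BMTS k
  M₂^ν = inst M₂ ν

  val : (XR → Bool) → (XT1 → Bool) → (XT2 → Bool) → Ap → Bool
  val r x₁ x₂ = [ r , [ x₁ , [ x₂ , [ μ , ν ] ] ] ]

  val-cong : ∀ {r r′ x₁ x₁′ x₂ x₂′} → r ≗ r′ → x₁ ≗ x₁′ → x₂ ≗ x₂′ → val r x₁ x₂ ≗ val r′ x₁′ x₂′
  val-cong r≗r′ x₁≗x₁′ x₂≗x₂′ = [,]-cong r≗r′ ([,]-cong x₁≗x₁′ ([,]-cong x₂≗x₂′ (λ _ → refl)))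

  Related : (XR → Bool) → Fin n₁ → Fin n₂ → Set
  Related r u v = r (u , v) ≡ true

  moves₁ : (XT1 → Bool) → (u : Fin n₁) → Out T₁ u → Bool
  moves₁ x₁ u o = x₁ (u , o)

  moves₂ : (XT2 → Bool) → (u : Fin n₁) (v : Fin n₂) → Out T₂ v → Bool
  moves₂ x₂ u v o = x₂ (u , v , o)

  ⊨-sameAct-∧ : ∀ {w : Ap → Bool} a b φ ψ → w ⊨ sameAct a b (φ ∧f ψ) ⇔ (w ⊨ φ × a ≡ b × w ⊨ ψ)
  ⊨-sameAct-∧ a b φ ψ with a Fin.≟ b
  ... | yes a≡b = mk⇔ (λ h → let p , q = to (⊨-∧ φ ψ) h in p , a≡b , q)
                      (λ (p , _ , q) → from (⊨-∧ φ ψ) (p , q))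
  ... | no a≢b  = mk⇔ (λ ()) (λ (_ , a≡b , _) → contradiction a≡b a≢b)

  XR-enum : IsEnumeration (setoid XR) (cartesianProduct (allFin n₁) (allFin n₂))
  XR-enum (u , v) = ∈-cartesianProduct⁺ (∈-allFin u) (∈-allFin v)

  XT1-enum : IsEnumeration (setoid XT1) _
  XT1-enum = Σ-isEnumeration ∈-allFin (enumOut-isEnumeration T₁)

  XT2-enum : IsEnumeration (setoid XT2) _
  XT2-enum = Σ-isEnumeration ∈-allFin (λ _ → Σ-isEnumeration ∈-allFin (enumOut-isEnumeration T₂))

  module _ (r : XR → Bool) (x₁ : XT1 → Bool) (x₂ : XT2 → Bool) where

    ⊨-π₁ : ∀ u → val r x₁ x₂ ⊨ π₁ u (Φ₁ u) ⇔ Tran M₁^μ u (moves₁ x₁ u)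
    ⊨-π₁ u = ⇔-true (trans (eval-bind _ _ (Φ₁ u))
                    (trans (eval-cong [ (λ _ → refl) , (λ _ → refl) ] (Φ₁ u))
                           (sym (eval-inst M₁ μ u _))))

    ⊨-π₂ : ∀ u v → val r x₁ x₂ ⊨ π₂ u v (Φ₂ v) ⇔ Tran M₂^ν v (moves₂ x₂ u v)
    ⊨-π₂ u v = ⇔-true (trans (eval-bind _ _ (Φ₂ v))
                      (trans (eval-cong [ (λ _ → refl) , (λ _ → refl) ] (Φ₂ v))
                             (sym (eval-inst M₂ ν v _))))

    ⊨-φ : ∀ u v → val r x₁ x₂ ⊨ φ u v ⇔ Matches M₁^μ M₂^ν (Related r) (moves₁ x₁ u) (moves₂ x₂ u v)
    ⊨-φ u v = ⇔-trans (⊨-∧ (⋀⇒⋁ a₁ g₁ out₁ out₂) (⋀⇒⋁ a₂ g₂ out₂ out₁))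
                      (⇔-trans (⊨-⋀⇒⋁ enum₁ enum₂ a₁ g₁) (∀⇒∃-cong (⊨-sameAct-∧ _ _ _ _)) ×-⇔
                       ⇔-trans (⊨-⋀⇒⋁ enum₂ enum₁ a₂ g₂) (∀⇒∃-cong (⊨-sameAct-∧ _ _ _ _)))
      where
      out₁ = enumOut T₁ u
      out₂ = enumOut T₂ v
      enum₁ = enumOut-isEnumeration T₁ u
      enum₂ = enumOut-isEnumeration T₂ v
      a₁ = λ o → aT1 (u , o)
      g₁ = λ o o′ → sameAct (act o) (act o′) (aT2 (u , v , o′) ∧f aR (tgt o , tgt o′))
      a₂ = λ o′ → aT2 (u , v , o′)
      g₂ = λ o′ o → sameAct (act o) (act o′) (aT1 (u , o) ∧f aR (tgt o , tgt o′))

    ⊨-ψ : ∀ u v → val r x₁ x₂ ⊨ ψ u v ⇔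
          (Tran M₁^μ u (moves₁ x₁ u) →
           Tran M₂^ν v (moves₂ x₂ u v) × Matches M₁^μ M₂^ν (Related r) (moves₁ x₁ u) (moves₂ x₂ u v))
    ⊨-ψ u v = ⇔-trans (⊨-⇒ (π₁ u (Φ₁ u)) (π₂ u v (Φ₂ v) ∧f φ u v))
                      (→-cong-⇔ (⊨-π₁ u) (⇔-trans (⊨-∧ (π₂ u v (Φ₂ v)) (φ u v)) (⊨-π₂ u v ×-⇔ ⊨-φ u v)))

    ⊨-Ψ : ∀ s t → val r x₁ x₂ ⊨ Ψ s t ⇔
          (Related r s t × (∀ u v → Related r u v → val r x₁ x₂ ⊨ ψ u v))
    ⊨-Ψ s t = ⇔-trans (⊨-∧ (aR (s , t)) (⋀ (map guarded (cartesianProduct (allFin n₁) (allFin n₂)))))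
                      (⇔-refl ×-⇔ ⇔-trans (⊨-⋀-enum guarded XR-enum) uncurried)
      where
      guarded = λ (uv : XR) → aR uv ⇒f ψ (proj₁ uv) (proj₂ uv)
      uncurried : (∀ uv → val r x₁ x₂ ⊨ guarded uv) ⇔ (∀ u v → Related r u v → val r x₁ x₂ ⊨ ψ u v)
      uncurried = mk⇔ (λ h u v → to (⊨-⇒ (aR (u , v)) (ψ u v)) (h (u , v)))
                      (λ h (u , v) → from (⊨-⇒ (aR (u , v)) (ψ u v)) (h u v))

  Certificate : Fin n₁ → Fin n₂ → (XR → Bool) → Set
  Certificate s t r = ∀ x₁ → ∃ λ x₂ → val r x₁ x₂ ⊨ Ψ s t

  certificate⇒refinement : ∀ {s t r} → Certificate s t r →
                           IsModalRefinement M₁^μ M₂^ν (Related r) × Related r s t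
  certificate⇒refinement {s} {t} {r} cert = isRef , proj₁ (Ψ-holds (λ _ → false))
    where
    Ψ-holds : ∀ x₁ → Related r s t × (∀ u v → Related r u v → val r x₁ (proj₁ (cert x₁)) ⊨ ψ u v)
    Ψ-holds x₁ = to (⊨-Ψ r x₁ (proj₁ (cert x₁)) s t) (proj₂ (cert x₁))
    isRef : IsModalRefinement M₁^μ M₂^ν (Related r)
    isRef u v ruv E tranE =
      moves₂ x₂ u v ,
      map₂ (Matches-respˡ M₁^μ M₂^ν fibre≗E) (response (trans (eval-cong fibre≗E (BMTS.Φ M₁^μ u)) tranE))
      where
      x₁ : XT1 → Bool
      x₁ = extend Fin._≟_ u E
      fibre≗E : moves₁ x₁ u ≗ E
      fibre≗E = extend-fibre Fin._≟_ u E
      x₂ = proj₁ (cert x₁)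
      response = to (⊨-ψ r x₁ x₂ u v) (proj₂ (Ψ-holds x₁) u v ruv)

  refinement⇒certificate : ∀ {s t r} → IsModalRefinement M₁^μ M₂^ν (Related r) → Related r s t →
                           Certificate s t r
  refinement⇒certificate {s} {t} {r} isRef rst x₁ =
    x₂ , from (⊨-Ψ r x₁ x₂ s t)
              (rst , λ u v ruv → from (⊨-ψ r x₁ x₂ u v) (respond-ok u v (challenged? u v) ruv))
    where
    Challenged : Fin n₁ → Fin n₂ → Set
    Challenged u v = Related r u v × Tran M₁^μ u (moves₁ x₁ u)
    challenged? : ∀ u v → Dec (Challenged u v)
    challenged? u v = r (u , v) Bool.≟ true ×-dec eval (moves₁ x₁ u) (BMTS.Φ M₁^μ u) Bool.≟ true
    respond : ∀ u v → Dec (Challenged u v) → Out T₂ v → Bool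
    respond u v (yes (ruv , tranE)) = proj₁ (isRef u v ruv (moves₁ x₁ u) tranE)
    respond u v (no _)              = λ _ → false
    respond-ok : ∀ u v d → Related r u v → Tran M₁^μ u (moves₁ x₁ u) →
                 Tran M₂^ν v (respond u v d) × Matches M₁^μ M₂^ν (Related r) (moves₁ x₁ u) (respond u v d)
    respond-ok u v (yes (ruv , tranE)) _ _ = proj₂ (isRef u v ruv (moves₁ x₁ u) tranE)
    respond-ok u v (no ¬c) ruv tranE = contradiction (ruv , tranE) ¬c
    x₂ : XT2 → Bool
    x₂ (u , v , o) = respond u v (challenged? u v) o

  certificate? : ∀ s t → Dec (∃ (Certificate s t))
  certificate? s t =
    searchable-enumeration XR-enum
      (λ r≗r′ cert x₁ → map₂ (⊨-resp (val-cong r≗r′ ≗-refl ≗-refl) (Ψ s t)) (cert x₁)) λ r →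
    ∀?-searchable (searchable-enumeration XT1-enum)
      (λ x₁≗x₁′ → map₂ (⊨-resp (val-cong ≗-refl x₁≗x₁′ ≗-refl) (Ψ s t))) λ x₁ →
    searchable-enumeration XT2-enum
      (λ x₂≗x₂′ → ⊨-resp (val-cong ≗-refl ≗-refl x₂≗x₂′) (Ψ s t)) λ x₂ →
    eval (val r x₁ x₂) (Ψ s t) Bool.≟ true
    where
    ≗-refl : ∀ {A : Set} {f : A → Bool} → f ≗ f
    ≗-refl _ = refl

theorem2 : ∀ {k : ℕ} (M₁ M₂ : PMTS k) (s : Fin (PMTS.n M₁)) (t : Fin (PMTS.n M₂)) →
    RefP M₁ s M₂ t ⇔ Encoding.QBFTrue M₁ M₂ s t
theorem2 M₁ M₂ s t = mk⇔ refinement⇒QBF QBF⇒refinement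
  where
  open EncodingCorrectness M₁ M₂

  QBF⇒refinement : Encoding.QBFTrue M₁ M₂ s t → RefP M₁ s M₂ t
  QBF⇒refinement qbf μ = let ν , r , cert = qbf μ in ν , Related μ ν r , certificate⇒refinement μ ν cert

  refinement⇒QBF : RefP M₁ s M₂ t → Encoding.QBFTrue M₁ M₂ s t
  refinement⇒QBF ref μ =
    let ν , R , isRef , Rst = ref μ
        certificate-from : (∀ u v → Dec (R u v)) → ∃ (Certificate μ ν s t)
        certificate-from R? = (λ (u , v) → does (R? u v)) ,
          refinement⇒certificate μ ν (IsModalRefinement-resp (inst M₁ μ) (inst M₂ ν) (does⇔ (R? _ _)) isRef)
                                     (to (does⇔ (R? s t)) Rst)
    in ν , decidable-stable (certificate? μ ν s t) (¬¬-map certificate-from (¬¬-decidable₂ R))
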